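{- Let $\mathbf{C}$ be a category with a stable system of monics $\mathcal{M}$ such that $\mathbf{C}$ has pullbacks along $\mathcal{M}$-morphisms and has final pullback complements along $\mathcal{M}$-morphisms. Then the target functor $T:\mathsf{FPC}_v(\mathbf{C},\mathcal{M})\to\mathbf{C}|_{\mathcal{M}}$ is a Grothendieck opfibration.
   Context: A stable system of monics in $\mathbf{C}$ is a class $\mathcal{M}$ of monomorphisms containing all isomorphisms, closed under composition, and stable under pullback. $\mathbf{C}|_{\mathcal{M}}$ is the category with the objects of $\mathbf{C}$ and morphisms the $\mathcal{M}$-morphisms. $\mathbf{C}$ has pullbacks along $\mathcal{M}$-morphisms if every cospan $A\to B\leftarrow B'$ with $B'\to B$ in $\mathcal{M}$ has a pullback. Given composable $f:A\to B$, $m:B\to C$, a pair $(n:A\to F,g:F\to C)$ is a final pullback complement (FPC) of $(f,m)$ if $g\circ n=m\circ f$, this square is a pullback, and for every pullback square $d\circ y=m\circ z$ (with $z:X\to B$, $y:X\to Y$, $d:Y\to C$) and every $x:X\to A$ with $f\circ x=z$ there is a unique $x':Y\to F$ with $g\circ x'=d$ and $x'\circ y=n\circ x$; $\mathbf{C}$ has FPCs along $\mathcal{M}$-morphisms if an FPC of $(f,m)$ exists whenever $m\in\mathcal{M}$. $\mathsf{FPC}_v(\mathbf{C},\mathcal{M})$ is the category whose objects are the morphisms of $\mathbf{C}$ and whose morphisms from $f:A\to B$ to $f':A'\to B'$ are pairs $(\alpha:A\to A',\beta:B\to B')$ with $\alpha,\beta\in\mathcal{M}$, $\beta\circ f=f'\circ\alpha$,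 and $(\alpha,f')$ an FPC of $(f,\beta)$; composition is by vertical pasting of squares. The target functor $T$ sends $f:A\to B$ to $B$ and $(\alpha,\beta)$ to $\beta$. For a functor $G:\mathbf{E}\to\mathbf{B}$, a morphism $\varphi:e\to e'$ is op-Cartesian if for every $\psi:e\to e''$ and every $u:G(e')\to G(e'')$ with $u\circ G(\varphi)=G(\psi)$ there is a unique $\chi:e'\to e''$ with $G(\chi)=u$ and $\chi\circ\varphi=\psi$; $G$ is a Grothendieck opfibration if for every object $e$ and every $f:G(e)\to b$ there is an op-Cartesian $\varphi$ with domain $e$ and $G(\varphi)=f$. -}

module Defs where

open import Level using (Level; _⊔_) renaming (suc to lsuc)
open import Data.Product using (Σ; _×_; _,_; Σ-syntax)
open import Relation.Binary.PropositionalEquality using (_≡_)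

record Category (o ℓ : Level) : Set (lsuc (o ⊔ ℓ)) where
  infixr 9 _∘_
  infix 4 _⇒_
  field
    Obj : Set o
    _⇒_ : Obj → Obj → Set ℓ
    id  : ∀ {A} → A ⇒ A
    _∘_ : ∀ {A B C} → B ⇒ C → A ⇒ B → A ⇒ C
    identityˡ : ∀ {A B} {f : A ⇒ B} → id ∘ f ≡ f
    identityʳ : ∀ {A B} {f : A ⇒ B} → f ∘ id ≡ f
    assoc : ∀ {A B C D} {f : A ⇒ B} {g : B ⇒ C} {h : C ⇒ D} →
            (h ∘ g) ∘ f ≡ h ∘ (g ∘ f)

∃!-syntax : ∀ {a p} (A : Set a) → (A → Set p) → Set (a ⊔ p)
∃!-syntax A P = Σ A (λ x → P x × (∀ y → P y → y ≡ x))
syntax ∃!-syntax A (λ x → P) = ∃![ x ∈ A ] P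

module Notions {o ℓ : Level} (C : Category o ℓ) where
  open Category C

  IsMono : ∀ {A B} → A ⇒ B → Set (o ⊔ ℓ)
  IsMono {A} f = ∀ {X} (g h : X ⇒ A) → f ∘ g ≡ f ∘ h → g ≡ h

  IsIso : ∀ {A B} → A ⇒ B → Set ℓ
  IsIso {A} {B} f = Σ[ g ∈ B ⇒ A ] (g ∘ f ≡ id × f ∘ g ≡ id)

  IsPullback : ∀ {P A B B'} (f : A ⇒ B) (m : B' ⇒ B) (p₁ : P ⇒ A) (p₂ : P ⇒ B') →
               Set (o ⊔ ℓ)
  IsPullback {P} {A} {B} {B'} f m p₁ p₂ =
    (f ∘ p₁ ≡ m ∘ p₂) ×
    (∀ {X} (x₁ : X ⇒ A) (x₂ : X ⇒ B') → f ∘ x₁ ≡ m ∘ x₂ →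
       ∃![ u ∈ X ⇒ P ] (p₁ ∘ u ≡ x₁ × p₂ ∘ u ≡ x₂))

  IsFPC : ∀ {A B C' F} (f : A ⇒ B) (m : B ⇒ C') (n : A ⇒ F) (g : F ⇒ C') →
          Set (o ⊔ ℓ)
  IsFPC {A} {B} {C'} {F} f m n g =
    (g ∘ n ≡ m ∘ f) ×
    IsPullback g m n f ×
    (∀ {X Y} (z : X ⇒ B) (y : X ⇒ Y) (d : Y ⇒ C') →
       IsPullback d m y z →
       (x : X ⇒ A) → f ∘ x ≡ z →
       ∃![ x' ∈ Y ⇒ F ] (g ∘ x' ≡ d × x' ∘ y ≡ n ∘ x))

  record StableSystem (ℓm : Level) : Set (o ⊔ ℓ ⊔ lsuc ℓm) where
    field
      M       : ∀ {A B} → A ⇒ B → Set ℓm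
      M-mono  : ∀ {A B} {m : A ⇒ B} → M m → IsMono m
      M-iso   : ∀ {A B} {f : A ⇒ B} → IsIso f → M f
      M-comp  : ∀ {A B D} {m : B ⇒ D} {m' : A ⇒ B} → M m → M m' → M (m ∘ m')
      M-stable : ∀ {P A B B'} {f : A ⇒ B} {m : B' ⇒ B} {p₁ : P ⇒ A} {p₂ : P ⇒ B'} →
                 M m → IsPullback f m p₁ p₂ → M p₁

  module _ {ℓm : Level} (𝓜 : StableSystem ℓm) where
    open StableSystem 𝓜

    HasPullbacksAlongM : Set (o ⊔ ℓ ⊔ ℓm)
    HasPullbacksAlongM = ∀ {A B B'} (f : A ⇒ B) (m : B' ⇒ B) → M m →
      Σ[ P ∈ Obj ] Σ[ p₁ ∈ P ⇒ A ] Σ[ p₂ ∈ P ⇒ B' ] IsPullback f m p₁ p₂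

    HasFPCsAlongM : Set (o ⊔ ℓ ⊔ ℓm)
    HasFPCsAlongM = ∀ {A B C'} (f : A ⇒ B) (m : B ⇒ C') → M m →
      Σ[ F ∈ Obj ] Σ[ n ∈ A ⇒ F ] Σ[ g ∈ F ⇒ C' ] IsFPC f m n g

    -- Objects of FPC_v(C, M): morphisms of C.
    record Arr : Set (o ⊔ ℓ) where
      constructor arr
      field
        {dom} : Obj
        {cod} : Obj
        hom   : dom ⇒ cod
    open Arr public

    record FPCHom (e e' : Arr) : Set (o ⊔ ℓ ⊔ ℓm) where
      field
        α   : dom e ⇒ dom e'
        β   : cod e ⇒ cod e'
        α∈M : M α
        β∈M : M β
        comm : β ∘ hom e ≡ hom e' ∘ α
        fpc  : IsFPC (hom e) β α (hom e')
    open FPCHom public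

    _≈ᶠ_ : ∀ {e e'} → FPCHom e e' → FPCHom e e' → Set ℓ
    φ ≈ᶠ ψ = (α φ ≡ α ψ) × (β φ ≡ β ψ)

    -- χ ∘ φ ≈ ψ in FPC_v (composition = vertical pasting = componentwise).
    ComposesTo : ∀ {e e' e''} → FPCHom e' e'' → FPCHom e e' → FPCHom e e'' → Set ℓ
    ComposesTo χ φ ψ = (α χ ∘ α φ ≡ α ψ) × (β χ ∘ β φ ≡ β ψ)

    -- Op-Cartesian morphisms for the target functor T : FPC_v(C,M) → C|_M,
    -- T(arr f) = cod, T(α , β) = β.
    IsOpCartesianT : ∀ {e e'} → FPCHom e e' → Set (o ⊔ ℓ ⊔ ℓm)
    IsOpCartesianT {e} {e'} φ =
      ∀ (e'' : Arr) (ψ : FPCHom e e'') (u : cod e' ⇒ cod e'') → M u →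
        u ∘ β φ ≡ β ψ →
        Σ[ χ ∈ FPCHom e' e'' ] ((β χ ≡ u × ComposesTo χ φ ψ) ×
          (∀ (χ' : FPCHom e' e'') → β χ' ≡ u × ComposesTo χ' φ ψ → χ' ≈ᶠ χ))

    TargetIsOpfibration : Set (o ⊔ ℓ ⊔ ℓm)
    TargetIsOpfibration =
      ∀ (e : Arr) {B : Obj} (b : cod e ⇒ B) → M b →
        Σ[ A' ∈ Obj ] Σ[ f' ∈ A' ⇒ B ] Σ[ φ ∈ FPCHom e (arr f') ]
          (β φ ≡ b × IsOpCartesianT φ)

{-# OPTIONS --safe #-}
module Submission where

-- Take the final pullback complement (n , g) of (f , b); the square (n , b) : f → g
-- is the op-Cartesian lift of b.  Given ψ = (α' , u ∘ b) : f → h, pushing the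
-- pullback square (n , g) along the mono u and using the FPC property of ψ gives
-- the unique k with k ∘ n = α' and h ∘ k = u ∘ g.  It remains to see that (k , h)
-- is an FPC of (g , u): if a vertical composite of squares and its top half are
-- FPCs, so is its bottom half, as one checks by pulling back along b and
-- combining the two universal properties.

open import Defs
open import Level using (Level; _⊔_)
open import Data.Product using (Σ-syntax; _×_; _,_; proj₁; proj₂)
open import Relation.Binary.PropositionalEquality
  using (_≡_; refl; sym; trans; cong; subst; module ≡-Reasoning)

module _ {o ℓ : Level} (C : Category o ℓ) where
  open Category C
  open Notions C
  open ≡-Reasoning

  extendˡ : ∀ {X Y Z W V} {a : Z ⇒ W} {b : Y ⇒ Z} {c : V ⇒ W} {d : Y ⇒ V}
            (x : X ⇒ Y) → a ∘ b ≡ c ∘ d → a ∘ (b ∘ x) ≡ c ∘ (d ∘ x)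
  extendˡ x e = trans (sym assoc) (trans (cong (_∘ x) e) assoc)

  extendʳ : ∀ {X Y Z W V} {a : Y ⇒ Z} {b : X ⇒ Y} {c : W ⇒ Z} {d : X ⇒ W}
            (x : Z ⇒ V) → a ∘ b ≡ c ∘ d → (x ∘ a) ∘ b ≡ (x ∘ c) ∘ d
  extendʳ x e = trans assoc (trans (cong (x ∘_) e) (sym assoc))

  JointlyMonic : ∀ {P A B} → P ⇒ A → P ⇒ B → Set (o ⊔ ℓ)
  JointlyMonic {P} p q =
    ∀ {X} (v w : X ⇒ P) → p ∘ v ≡ p ∘ w → q ∘ v ≡ q ∘ w → v ≡ w

  HasPullbacksAlong : ∀ {B B'} → B ⇒ B' → Set (o ⊔ ℓ)
  HasPullbacksAlong {B} {B'} b =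
    ∀ {X} (k : X ⇒ B') → Σ[ Q ∈ Obj ] Σ[ y ∈ Q ⇒ X ] Σ[ z ∈ Q ⇒ B ] IsPullback k b y z

  pullback-jointlyMonic : ∀ {P A B B'} {f : A ⇒ B} {m : B' ⇒ B} {p₁ : P ⇒ A}
                          {p₂ : P ⇒ B'} → IsPullback f m p₁ p₂ → JointlyMonic p₁ p₂
  pullback-jointlyMonic {p₁ = p₁} {p₂} (sq , univ) v w e₁ e₂ =
    let (_ , _ , unique) = univ (p₁ ∘ w) (p₂ ∘ w) (extendˡ w sq)
    in trans (unique v (e₁ , e₂)) (sym (unique w (refl , refl)))

  pullback-∘-mono : ∀ {P A B B' D} {d : A ⇒ B} {m : B' ⇒ B} {y : P ⇒ A} {z : P ⇒ B'}
                    {u : B ⇒ D} → IsMono u → IsPullback d m y z →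
                    IsPullback (u ∘ d) (u ∘ m) y z
  pullback-∘-mono {u = u} u-mono (sq , univ) =
    trans assoc (trans (cong (u ∘_) sq) (sym assoc)) ,
    λ x₁ x₂ e → univ x₁ x₂ (u-mono _ _ (trans (sym assoc) (trans e assoc)))

  pullback-paste : ∀ {X Y Q B'' B' B} {d : Y ⇒ B''} {u : B' ⇒ B''} {y : X ⇒ Y}
                   {z : X ⇒ B'} {b : B ⇒ B'} {q : Q ⇒ X} {r : Q ⇒ B} →
                   IsPullback d u y z → IsPullback z b q r →
                   IsPullback d (u ∘ b) (y ∘ q) r
  pullback-paste {Y = Y} {Q} {B = B} {d = d} {u} {y} {z} {b} {q} {r} (sq₁ , univ₁) (sq₂ , univ₂) =
    trans (extendˡ q sq₁) (trans (cong (u ∘_) sq₂) (sym assoc)) , univ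
    where
    univ : ∀ {W} (x₁ : W ⇒ Y) (x₂ : W ⇒ B) → d ∘ x₁ ≡ (u ∘ b) ∘ x₂ →
           ∃![ w ∈ W ⇒ Q ] ((y ∘ q) ∘ w ≡ x₁ × r ∘ w ≡ x₂)
    univ x₁ x₂ e =
      let (v , (yv , zv) , unique₁) = univ₁ x₁ (b ∘ x₂) (trans e assoc)
          (w , (qw , rw) , unique₂) = univ₂ v x₂ zv
      in w , (trans assoc (trans (cong (y ∘_) qw) yv) , rw) ,
         λ w' (yqw' , rw') → unique₂ w'
           (unique₁ (q ∘ w') (trans (sym assoc) yqw' ,
                              trans (extendˡ w' sq₂) (cong (b ∘_) rw')) , rw')

  FPC-pullback : ∀ {A B C' F} {f : A ⇒ B} {m : B ⇒ C'} {n : A ⇒ F} {g : F ⇒ C'} →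
                 IsFPC f m n g → IsPullback g m n f
  FPC-pullback (_ , pb , _) = pb

  IsFPC-unique : ∀ {A B C' F X Y} {f : A ⇒ B} {m : B ⇒ C'} {n : A ⇒ F} {g : F ⇒ C'}
                 {z : X ⇒ B} {y : X ⇒ Y} {d : Y ⇒ C'} {x : X ⇒ A} →
                 IsFPC f m n g → IsPullback d m y z → f ∘ x ≡ z →
                 (v w : Y ⇒ F) → g ∘ v ≡ d → v ∘ y ≡ n ∘ x →
                 g ∘ w ≡ d → w ∘ y ≡ n ∘ x → v ≡ w
  IsFPC-unique (_ , _ , univ) pb fx v w gv vy gw wy =
    let (_ , _ , unique) = univ _ _ _ pb _ fx
    in trans (unique v (gv , vy)) (sym (unique w (gw , wy)))

  FPC-jointlyMonic : ∀ {A B B' F D} {f : A ⇒ B} {b : B ⇒ B'} {n : A ⇒ F} {g : F ⇒ B'}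
                     {k : F ⇒ D} → IsFPC f b n g → HasPullbacksAlong b →
                     JointlyMonic (k ∘ n) f → JointlyMonic g k
  FPC-jointlyMonic {n = n} {g} {k} fpc pullbacks-along-b kn-f-monic w₁ w₂ gw kw
    with pullbacks-along-b (g ∘ w₁)
  ... | Q , y , z , pbQ@(gw₁y , _)
    with proj₂ (FPC-pullback fpc) (w₁ ∘ y) z (trans (sym assoc) gw₁y)
       | proj₂ (FPC-pullback fpc) (w₂ ∘ y) z
           (trans (sym assoc) (trans (cong (_∘ y) (sym gw)) gw₁y))
  ... | a₁ , (na₁ , fa₁) , _ | a₂ , (na₂ , fa₂) , _ =
    IsFPC-unique fpc pbQ fa₁ w₁ w₂ refl (sym na₁) (sym gw)
      (trans (sym na₂) (cong (n ∘_) (sym a₁≡a₂)))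
    where
    a₁≡a₂ : a₁ ≡ a₂
    a₁≡a₂ = kn-f-monic a₁ a₂
      (begin
        (k ∘ n) ∘ a₁   ≡⟨ extendʳ k na₁ ⟩
        (k ∘ w₁) ∘ y   ≡⟨ cong (_∘ y) kw ⟩
        (k ∘ w₂) ∘ y   ≡⟨ sym (extendʳ k na₂) ⟩
        (k ∘ n) ∘ a₂   ∎)
      (trans fa₁ (sym fa₂))

  module FPC-decomposition
    {A B B' F A'' B''} {f : A ⇒ B} {b : B ⇒ B'} {n : A ⇒ F} {g : F ⇒ B'}
    (top : IsFPC f b n g) (pullbacks-along-b : HasPullbacksAlong b)
    {h : A'' ⇒ B''} {u : B' ⇒ B''} {α' : A ⇒ A''}
    (u-mono : IsMono u) (outer : IsFPC f (u ∘ b) α' h)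
    {k : F ⇒ A''} (hk : h ∘ k ≡ u ∘ g) (kn : k ∘ n ≡ α')
    where

    hk-extend : ∀ {X} {x : X ⇒ F} {z : X ⇒ B'} → g ∘ x ≡ z → h ∘ (k ∘ x) ≡ u ∘ z
    hk-extend {x = x} gx = trans (extendˡ x hk) (cong (u ∘_) gx)

    kn-extend : ∀ {X Y} {w : Y ⇒ F} {y : X ⇒ Y} {a : X ⇒ A} →
                w ∘ y ≡ n ∘ a → (k ∘ w) ∘ y ≡ α' ∘ a
    kn-extend {a = a} wy = trans (extendʳ k wy) (cong (_∘ a) kn)

    g-k-jointlyMonic : JointlyMonic g k
    g-k-jointlyMonic = FPC-jointlyMonic top pullbacks-along-b
      (subst (λ a → JointlyMonic a f) (sym kn) (pullback-jointlyMonic (FPC-pullback outer)))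

    bottom-pullback : IsPullback h u k g
    bottom-pullback = hk , univ
      where
      univ : ∀ {X} (x₁ : X ⇒ A'') (x₂ : X ⇒ B') → h ∘ x₁ ≡ u ∘ x₂ →
             ∃![ w ∈ X ⇒ F ] (k ∘ w ≡ x₁ × g ∘ w ≡ x₂)
      univ x₁ x₂ hx₁ with pullbacks-along-b x₂
      ... | Q , y , z , pbQ@(x₂y , _)
        with proj₂ (FPC-pullback outer) (x₁ ∘ y) z
               (trans (extendˡ y hx₁) (trans (cong (u ∘_) x₂y) (sym assoc)))
      ... | a , (α'a , fa) , _ with proj₂ (proj₂ top) z y x₂ pbQ a fa
      ... | x' , (gx' , x'y) , _ =
        x' , (kx' , gx') ,
        λ w (kw , gw) → g-k-jointlyMonic w x' (trans gw (sym gx')) (trans kw (sym kx'))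
        where
        kx' : k ∘ x' ≡ x₁
        kx' = IsFPC-unique outer (pullback-∘-mono u-mono pbQ) fa (k ∘ x') x₁
                (hk-extend gx') (kn-extend x'y) hx₁ (sym α'a)

    bottom-universal : ∀ {X Y} (z : X ⇒ B') (y : X ⇒ Y) (d : Y ⇒ B'') →
                       IsPullback d u y z → (x : X ⇒ F) → g ∘ x ≡ z →
                       ∃![ x' ∈ Y ⇒ A'' ] (h ∘ x' ≡ d × x' ∘ y ≡ k ∘ x)
    bottom-universal z y d pbd x gx with pullbacks-along-b z
    ... | Q , q , r , pbQ@(zq , _)
      with proj₂ (FPC-pullback top) (x ∘ q) r
             (trans (sym assoc) (trans (cong (_∘ q) gx) zq))
    ... | a , (na , fa) , _ with proj₂ (proj₂ outer) r (y ∘ q) d (pullback-paste pbd pbQ) a fa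
    ... | x' , (hx' , x'yq) , unique =
      x' , (hx' , x'y) ,
      λ w (hw , wy) → unique w (hw , trans (sym assoc) (trans (cong (_∘ q) wy) kxq))
      where
      kxq : (k ∘ x) ∘ q ≡ α' ∘ a
      kxq = kn-extend (sym na)
      x'y : x' ∘ y ≡ k ∘ x
      x'y = IsFPC-unique outer (pullback-∘-mono u-mono pbQ) fa (x' ∘ y) (k ∘ x)
              (trans (sym assoc) (trans (cong (_∘ y) hx') (proj₁ pbd))) (trans assoc x'yq)
              (hk-extend gx) kxq

    bottom-FPC : IsFPC g u k h
    bottom-FPC = hk , bottom-pullback , bottom-universal

module _ {o ℓ ℓm : Level} {C : Category o ℓ} (𝓜 : Notions.StableSystem C ℓm) where
  open Category C
  open Notions C
  open StableSystem 𝓜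

  FPC-square : ∀ {A B B' F} {f : A ⇒ B} {b : B ⇒ B'} {n : A ⇒ F} {g : F ⇒ B'} →
               M b → IsFPC f b n g → FPCHom 𝓜 (arr f) (arr g)
  FPC-square {b = b} {n} b∈M fpc = record
    { α = n ; β = b ; α∈M = M-stable b∈M (FPC-pullback C fpc) ; β∈M = b∈M
    ; comm = sym (proj₁ fpc) ; fpc = fpc }

  FPC-square-isOpCartesian :
    ∀ {A B B' F} {f : A ⇒ B} {b : B ⇒ B'} {n : A ⇒ F} {g : F ⇒ B'} →
    (b∈M : M b) (fpc : IsFPC f b n g) → HasPullbacksAlong C b →
    IsOpCartesianT 𝓜 (FPC-square b∈M fpc)
  FPC-square-isOpCartesian {F = F} {f} {b} {n} {g} b∈M fpc pullbacks-along-b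
                           (arr h) ψ u u∈M ub≡β = χ , (refl , kn , ub≡β) , unique
    where
    outer : IsFPC f (u ∘ b) (α ψ) h
    outer = subst (λ β → IsFPC f β (α ψ) h) (sym ub≡β) (FPCHom.fpc ψ)

    factorisation : ∃![ k ∈ _ ⇒ _ ] (h ∘ k ≡ u ∘ g × k ∘ n ≡ α ψ ∘ id)
    factorisation = proj₂ (proj₂ outer) f n (u ∘ g)
      (pullback-∘-mono C (M-mono u∈M) (FPC-pullback C fpc)) id identityʳ

    k : F ⇒ _
    k = proj₁ factorisation

    hk : h ∘ k ≡ u ∘ g
    hk = proj₁ (proj₁ (proj₂ factorisation))

    kn : k ∘ n ≡ α ψ
    kn = trans (proj₂ (proj₁ (proj₂ factorisation))) identityʳ

    open FPC-decomposition C fpc pullbacks-along-b (M-mono u∈M) outer hk kn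

    χ : FPCHom 𝓜 (arr g) (arr h)
    χ = record { α = k ; β = u ; α∈M = M-stable u∈M bottom-pullback ; β∈M = u∈M
               ; comm = sym hk ; fpc = bottom-FPC }

    unique : ∀ χ' → β χ' ≡ u × ComposesTo 𝓜 χ' (FPC-square b∈M fpc) ψ → _≈ᶠ_ 𝓜 χ' χ
    unique χ' (βχ'≡u , αχ'n , _) =
      proj₂ (proj₂ factorisation) (α χ')
        (trans (sym (comm χ')) (cong (_∘ g) βχ'≡u) , trans αχ'n (sym identityʳ)) ,
      βχ'≡u

theorem3 : ∀ {o ℓ ℓm : Level} (C : Category o ℓ) (𝓜 : Notions.StableSystem C ℓm) →
           Notions.HasPullbacksAlongM C 𝓜 →
           Notions.HasFPCsAlongM C 𝓜 →
           Notions.TargetIsOpfibration C 𝓜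
theorem3 C 𝓜 pullbacks fpcs (Notions.arr f) b b∈M =
  let (F , n , g , fpc) = fpcs f b b∈M
  in F , g , FPC-square 𝓜 b∈M fpc , refl ,
     FPC-square-isOpCartesian 𝓜 b∈M fpc (λ k → pullbacks k b b∈M)
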